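{- Let $M=(\Sigma_\Box,Q,q_{in},q_{fin},\delta)$ be a Turing machine. There is a term $\mathtt{final}$ of $\Lambda_{\tt det}$ such that for every continuation $k$ (a value), every $s\in\Sigma^*$ and every final configuration $C$ for $s$, i.e. $C=(\varepsilon,\Box,s,q_{fin})$, $$\mathtt{final}\; k\; \ulcorner C\urcorner \rightarrow_{det}^{\Theta(|s|)} k\; \ulcorner s\urcorner_{\Sigma^*}.$$
   Context: $\Lambda_{\tt det}$: terms $t ::= v \mid t\,v$, values $v ::= \lambda x.t \mid x$; evaluation contexts $E ::= [\cdot] \mid E\,v$; reduction $E[(\lambda x.t)s] \rightarrow_{det} E[t\{x:=s\}]$; $\rightarrow_{det}^{\Theta(|s|)}$ is a reduction of $\Theta(|s|)$ steps, constants depending only on $M$. A Turing machine $M$ has a finite alphabet $\Sigma=\{a_1,\dots,a_n\}$ plus a blank symbol $\Box$ (tape alphabet $\Sigma_\Box=\Sigma\cup\{\Box\}$, $\Box$ last in the order), a finite state set $Q=\{q_1,\dots,q_m\}$, initial and final states $q_{in},q_{fin}$, and a partial transition function $\delta$ from $Q\times\Sigma_\Box$ to $Q\times\Sigma_\Box\times\{\leftarrow,\rightarrow,\downarrow\}$ defined exactly on pairs whose state is not $q_{fin}$. A configuration is a quadruple $(s,a,r,q)$: tape left of the head $s$, symbol under the head $a$, tape right of the head $r$, state $q$. Scott encoding for an ordered alphabet $\Delta=\{b_1,\dots,b_n\}$: $\ulcorner b_i\urcorner_\Delta := \lambda x_1.\dots\lambda x_n.x_i$, $\ulcorner \varepsilon\urcorner_{\Delta^*}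 := \lambda x_1.\dots\lambda x_n.\lambda y.y$, $\ulcorner b_i r\urcorner_{\Delta^*} := \lambda x_1.\dots\lambda x_n.\lambda y.x_i\,\ulcorner r\urcorner_{\Delta^*}$; $Q$ is encoded as an alphabet. Configurations: $\ulcorner (s,a,r,q)\urcorner := \lambda x.\, x\,\ulcorner s^r\urcorner_{\Sigma_\Box^*}\,\ulcorner a\urcorner_{\Sigma_\Box}\,\ulcorner r\urcorner_{\Sigma_\Box^*}\,\ulcorner q\urcorner_Q$, with $s^r$ the reversal of $s$. -}

module Defs where

open import Data.Nat using (ℕ; zero; suc; _+_; _*_; _∸_; _≤_; _<_; compare; less; equal; greater)
open import Data.Fin using (Fin; toℕ; fromℕ; inject₁)
open import Data.List using (List; []; _∷_; length; map; reverse)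
open import Data.Product using (_×_; Σ; ∃; _,_)
open import Relation.Binary.PropositionalEquality using (_≡_; _≢_)

-- Λ_det, with de Bruijn indices
--   terms  t ::= v | t v        values  v ::= λ t | x

mutual
  data Term : Set where
    val : Val → Term
    app : Term → Val → Term

  data Val : Set where
    var : ℕ → Val
    lam : Term → Val

shiftVar : ℕ → ℕ → ℕ
shiftVar zero    x       = suc x
shiftVar (suc c) zero    = zero
shiftVar (suc c) (suc x) = suc (shiftVar c x)

mutual
  shiftT : ℕ → Term → Term
  shiftT c (val v)   = val (shiftV c v)
  shiftT c (app t v) = app (shiftT c t) (shiftV c v)

  shiftV : ℕ → Val → Val
  shiftV c (var x) = var (shiftVar c x)
  shiftV c (lam t) = lam (shiftT (suc c) t)

-- substituting the value s for index j (s already lifted to the binding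
-- depth j), lowering the indices above j
substVar : ℕ → Val → ℕ → Val
substVar j s x with compare x j
... | less    _ _ = var x
... | equal   _   = s
... | greater _ k = var (j + k)

mutual
  substT : ℕ → Val → Term → Term
  substT j s (val v)   = val (substV j s v)
  substT j s (app t v) = app (substT j s t) (substV j s v)

  substV : ℕ → Val → Val → Val
  substV j s (lam t) = lam (substT (suc j) (shiftV 0 s) t)
  substV j s (var x) = substVar j s x

_[_] : Term → Val → Term
t [ s ] = substT 0 s t

-- weak head deterministic reduction  E[(λx.t)s] → E[t{x:=s}],  E ::= [·] | E v
data _⟶_ : Term → Term → Set where
  β   : ∀ {t s} → app (val (lam t)) s ⟶ (t [ s ])
  ctx : ∀ {t t' v} → t ⟶ t' → app t v ⟶ app t' v

data _⟶[_]_ : Term → ℕ → Term → Set where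
  done : ∀ {t} → t ⟶[ 0 ] t
  step : ∀ {t t' u n} → t ⟶ t' → t' ⟶[ n ] u → t ⟶[ suc n ] u

-- Scott encodings over an ordered alphabet {b_1,…,b_N} represented by Fin N

lams : ℕ → Term → Term
lams zero    t = t
lams (suc k) t = val (lam (lams k t))

-- ⌜ b_i ⌝ = λx_1…λx_N. x_i   (i 0-based here; x_i has index N-1-i)
⌜_⌝sym : ∀ {N} → Fin N → Val
⌜_⌝sym {suc N} i = lam (lams N (val (var (N ∸ toℕ i))))

-- ⌜ ε ⌝ = λx_1…λx_N.λy.y ,  ⌜ b_i r ⌝ = λx_1…λx_N.λy. x_i ⌜ r ⌝
⌜_⌝str : ∀ {N} → List (Fin N) → Val
⌜_⌝str {N} []      = lam (lams N (val (var 0)))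
⌜_⌝str {N} (i ∷ r) = lam (lams N (app (val (var (N ∸ toℕ i))) ⌜ r ⌝str))

-- Turing machines.  Σ = Fin n, Σ_□ = Fin (suc n) with □ = fromℕ n the last
-- symbol, Q = Fin m.

data Move : Set where
  mvL mvR mvStay : Move

record TM : Set where
  field
    n   : ℕ
    m   : ℕ
    qin  : Fin m
    qfin : Fin m
    δ   : (q : Fin m) → q ≢ qfin → Fin (suc n) → Fin m × Fin (suc n) × Move

Sym□ : TM → Set
Sym□ M = Fin (suc (TM.n M))

Sym : TM → Set
Sym M = Fin (TM.n M)

State : TM → Set
State M = Fin (TM.m M)

blank : (M : TM) → Sym□ M
blank M = fromℕ (TM.n M)

record Config (M : TM) : Set where
  constructor config
  field
    left  : List (Sym□ M)
    head  : Sym□ M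
    right : List (Sym□ M)
    state : State M

⌜_⌝conf : ∀ {M} → Config M → Val
⌜ config s a r q ⌝conf =
  lam (app (app (app (app (val (var 0)) ⌜ reverse s ⌝str) ⌜ a ⌝sym) ⌜ r ⌝str) ⌜ q ⌝sym)

finalConfig : (M : TM) → List (Sym M) → Config M
finalConfig M s = config [] (blank M) (map inject₁ s) (TM.qfin M)

-- final k C = C X k hands the four components of C to X, which starts a loop G G r ε k
-- on the right part r of the tape. One round of the loop is a Scott case analysis of r
-- (one argument per letter, hence |Σ| + O(1) β-steps) followed by a continuation-passing
-- cons of the letter onto the accumulator, so the loop reverses r into the accumulator
-- in a constant number of steps per letter. Reversing a second time, now over Σ, yields
-- ⌜ s ⌝ in Θ(|s|) steps in total. Every combinator involved is λx₁…xₘ.λk. applied to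
-- atoms, so all its reductions are instances of a single instantiation lemma.
module Submission where

open import Defs
open import Data.Nat
  using (ℕ; zero; suc; _+_; _*_; _∸_; _≤_; _<_; z≤n; s≤s; pred; compare; less; equal; greater; _<?_)
open import Data.Nat.Properties
open import Data.Nat.Tactic.RingSolver using (solve-∀)
open import Data.Fin using (Fin; zero; suc; toℕ; inject₁; #_)
open import Data.List using (List; []; _∷_; length; map; reverse; _++_; _ʳ++_)
open import Data.List.Properties using (map-∘; map-cong; map-id; reverse-involutive; length-reverse)
open import Data.Vec using (Vec; []; _∷_; lookup; toList; tabulate; _∷ʳ_)
open import Data.Vec.Properties using (lookup∘tabulate)
open import Data.Vec.Relation.Unary.All using (All; []; _∷_)
open import Data.Vec.Relation.Unary.All.Properties using (tabulate⁺)
open import Data.Product using (Σ; ∃; _×_; _,_)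
open import Data.Empty using (⊥-elim)
open import Function using (_∘_; id)
open import Relation.Nullary using (yes; no)
open import Relation.Binary.PropositionalEquality hiding ([_])

private
  variable
    d j m N : ℕ
    t u : Term
    c k x : Val

lookup-∷ʳ-inject₁ : ∀ {n} {A : Set} (xs : Vec A n) y i →
  lookup (xs ∷ʳ y) (inject₁ i) ≡ lookup xs i
lookup-∷ʳ-inject₁ (x ∷ xs) y zero    = refl
lookup-∷ʳ-inject₁ (x ∷ xs) y (suc i) = lookup-∷ʳ-inject₁ xs y i

All-∷ʳ : ∀ {n} {A : Set} {P : A → Set} {xs : Vec A n} {y} →
  All P xs → P y → All P (xs ∷ʳ y)
All-∷ʳ []       py = py ∷ []
All-∷ʳ (p ∷ ps) py = p ∷ All-∷ʳ ps py

infixr 5 _◅◅_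

_◅◅_ : ∀ {t u v p q} → t ⟶[ p ] u → u ⟶[ q ] v → t ⟶[ p + q ] v
done     ◅◅ q = q
step r p ◅◅ q = step r (p ◅◅ q)

cast-target : ∀ {t u v i} → u ≡ v → t ⟶[ i ] u → t ⟶[ i ] v
cast-target refl p = p

cast-source : ∀ {t u v i} → t ≡ u → u ⟶[ i ] v → t ⟶[ i ] v
cast-source refl p = p

cast-steps : ∀ {t u i i′} → i ≡ i′ → t ⟶[ i ] u → t ⟶[ i′ ] u
cast-steps refl p = p

β≡ : t [ c ] ≡ u → app (val (lam t)) c ⟶ u
β≡ refl = β

spine : Term → List Val → Term
spine t []       = t
spine t (v ∷ vs) = spine (app t v) vs

spine-++ : ∀ t vs ws → spine t (vs ++ ws) ≡ spine (spine t vs) ws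
spine-++ t []       ws = refl
spine-++ t (v ∷ vs) ws = spine-++ (app t v) vs ws

spine-⟶ : ∀ vs → t ⟶ u → spine t vs ⟶ spine u vs
spine-⟶ []       r = r
spine-⟶ (v ∷ vs) r = spine-⟶ vs (ctx r)

substT-spine : ∀ j s t vs → substT j s (spine t vs) ≡ spine (substT j s t) (map (substV j s) vs)
substT-spine j s t []       = refl
substT-spine j s t (v ∷ vs) = substT-spine j s (app t v) vs

substVar-< : ∀ {j x} s → x < j → substVar j s x ≡ var x
substVar-< {j} {x} s x<j with compare x j
... | less _ _    = refl
... | equal _     = ⊥-elim (<-irrefl refl x<j)
... | greater y z = ⊥-elim (<-asym x<j (s≤s (m≤m+n y z)))

substVar-≡ : ∀ {j x} s → x ≡ j → substVar j s x ≡ s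
substVar-≡ {j} {x} s x≡j with compare x j
... | less y _    = ⊥-elim (m≢1+m+n y x≡j)
... | equal _     = refl
... | greater y _ = ⊥-elim (m≢1+m+n y (sym x≡j))

substVar-> : ∀ {j x} s → j < x → substVar j s x ≡ var (pred x)
substVar-> {j} {x} s j<x with compare x j
... | less y z    = ⊥-elim (<-asym j<x (s≤s (m≤m+n y z)))
... | equal _     = ⊥-elim (<-irrefl refl j<x)
... | greater _ _ = refl

shiftVar-< : ∀ c x → x < c → shiftVar c x ≡ x
shiftVar-< (suc c) zero    _         = refl
shiftVar-< (suc c) (suc x) (s≤s x<c) = cong suc (shiftVar-< c x x<c)

shiftVar-≥ : ∀ c x → c ≤ x → shiftVar c x ≡ suc x
shiftVar-≥ zero    x       _         = refl
shiftVar-≥ (suc c) (suc x) (s≤s c≤x) = cong suc (shiftVar-≥ c x c≤x)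

mutual
  substT-shiftT : ∀ j s t → substT j s (shiftT j t) ≡ t
  substT-shiftT j s (val v)   = cong val (substV-shiftV j s v)
  substT-shiftT j s (app t v) = cong₂ app (substT-shiftT j s t) (substV-shiftV j s v)

  substV-shiftV : ∀ j s v → substV j s (shiftV j v) ≡ v
  substV-shiftV j s (lam t) = cong lam (substT-shiftT (suc j) (shiftV 0 s) t)
  substV-shiftV j s (var x) with x <? j
  ... | yes x<j = trans (cong (substVar j s) (shiftVar-< j x x<j)) (substVar-< s x<j)
  ... | no x≮j  = trans (cong (substVar j s) (shiftVar-≥ j x j≤x)) (substVar-> s (s≤s j≤x))
    where j≤x = ≮⇒≥ x≮j

mutual
  data ScopedT (d : ℕ) : Term → Set where
    val : ∀ {v} → ScopedV d v → ScopedT d (val v)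
    app : ∀ {t v} → ScopedT d t → ScopedV d v → ScopedT d (app t v)

  data ScopedV (d : ℕ) : Val → Set where
    var : ∀ {x} → x < d → ScopedV d (var x)
    lam : ∀ {t} → ScopedT (suc d) t → ScopedV d (lam t)

Closed : Val → Set
Closed = ScopedV 0

mutual
  shiftT-scoped : ∀ {c t} → ScopedT d t → d ≤ c → shiftT c t ≡ t
  shiftT-scoped (val p)   d≤c = cong val (shiftV-scoped p d≤c)
  shiftT-scoped (app p q) d≤c = cong₂ app (shiftT-scoped p d≤c) (shiftV-scoped q d≤c)

  shiftV-scoped : ∀ {c v} → ScopedV d v → d ≤ c → shiftV c v ≡ v
  shiftV-scoped {c = c} (var {x} x<d) d≤c = cong var (shiftVar-< c x (<-≤-trans x<d d≤c))
  shiftV-scoped (lam p)               d≤c = cong lam (shiftT-scoped p (s≤s d≤c))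

mutual
  substT-scoped : ∀ {t} s → ScopedT d t → d ≤ j → substT j s t ≡ t
  substT-scoped s (val p)   d≤j = cong val (substV-scoped s p d≤j)
  substT-scoped s (app p q) d≤j = cong₂ app (substT-scoped s p d≤j) (substV-scoped s q d≤j)

  substV-scoped : ∀ {v} s → ScopedV d v → d ≤ j → substV j s v ≡ v
  substV-scoped s (var x<d) d≤j = substVar-< s (<-≤-trans x<d d≤j)
  substV-scoped s (lam p)   d≤j = cong lam (substT-scoped (shiftV 0 s) p (s≤s d≤j))

mutual
  scopedT-≤ : ∀ {d′ t} → ScopedT d t → d ≤ d′ → ScopedT d′ t
  scopedT-≤ (val p)   d≤d′ = val (scopedV-≤ p d≤d′)
  scopedT-≤ (app p q) d≤d′ = app (scopedT-≤ p d≤d′) (scopedV-≤ q d≤d′)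

  scopedV-≤ : ∀ {d′ v} → ScopedV d v → d ≤ d′ → ScopedV d′ v
  scopedV-≤ (var x<d) d≤d′ = var (<-≤-trans x<d d≤d′)
  scopedV-≤ (lam p)   d≤d′ = lam (scopedT-≤ p (s≤s d≤d′))

closed-scoped : Closed c → ScopedV d c
closed-scoped p = scopedV-≤ p z≤n

substV-closed : ∀ s → Closed c → substV j s c ≡ c
substV-closed s p = substV-scoped s p z≤n

lams-scoped : ∀ k → ScopedT (k + d) t → ScopedT d (lams k t)
lams-scoped zero    p = p
lams-scoped {d} {t} (suc k) p =
  val (lam (lams-scoped k (subst (λ e → ScopedT e t) (sym (+-suc k d)) p)))

substT-lams : ∀ k → Closed c → substT j c (lams k t) ≡ lams k (substT (k + j) c t)
substT-lams zero    p = refl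
substT-lams {c} {j} {t} (suc k) p = cong (λ b → val (lam b)) (begin
  substT (suc j) (shiftV 0 c) (lams k t)
    ≡⟨ cong (λ s → substT (suc j) s (lams k t)) (shiftV-scoped p z≤n) ⟩
  substT (suc j) c (lams k t)
    ≡⟨ substT-lams k p ⟩
  lams k (substT (k + suc j) c t)
    ≡⟨ cong (λ i → lams k (substT i c t)) (+-suc k j) ⟩
  lams k (substT (suc k + j) c t) ∎)
  where open ≡-Reasoning

m∸n<m+[1+o] : ∀ m n o → m ∸ n < m + suc o
m∸n<m+[1+o] m n o = ≤-<-trans (m∸n≤m m n) (m<m+n m (s≤s z≤n))

-- Scott cons on an arbitrary tail: ⌜ i ∷ r ⌝str is definitionally scons i ⌜ r ⌝str.
scons : Fin N → Val → Val
scons {N} i v = lam (lams N (app (val (var (N ∸ toℕ i))) v))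

scons-scoped : (i : Fin N) → ScopedV (N + suc d) c → ScopedV d (scons i c)
scons-scoped {N} {d} i p = lam (lams-scoped N (app (val (var (m∸n<m+[1+o] N (toℕ i) d))) p))

substV-scons : (i : Fin N) → Closed c → ∀ v →
  substV j c (scons i v) ≡ scons i (substV (N + suc j) c v)
substV-scons {N} {c} {j} i p v = begin
  lam (substT (suc j) (shiftV 0 c) (lams N b))
    ≡⟨ cong (λ s → lam (substT (suc j) s (lams N b))) (shiftV-scoped p z≤n) ⟩
  lam (substT (suc j) c (lams N b))
    ≡⟨ cong lam (substT-lams N p) ⟩
  lam (lams N (substT (N + suc j) c b))
    ≡⟨ cong (λ h → lam (lams N (app (val h) (substV (N + suc j) c v)))) (substVar-< c letter<) ⟩
  scons i (substV (N + suc j) c v) ∎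
  where
  open ≡-Reasoning
  b = app (val (var (N ∸ toℕ i))) v
  letter< = m∸n<m+[1+o] N (toℕ i) j

-- A combinator λx₁…xₘ.λk. h a₁ … aₗ whose head and arguments are atoms: one of the m
-- arguments x_i (de Bruijn index m ∸ i), the last argument k (index 0), a closed
-- literal, or a Scott cons of a letter onto some x_i.
data Atom (m : ℕ) : Set where
  arg  : Fin m → Atom m
  cont : Atom m
  lit  : (v : Val) → Closed v → Atom m
  cons : Fin N → Fin m → Atom m

record Comb (m : ℕ) : Set where
  constructor _∙_
  field
    head : Atom m
    args : List (Atom m)

open Comb

toVal : Atom m → Val
toVal {m} (arg i)        = var (m ∸ toℕ i)
toVal     cont           = var 0
toVal     (lit v _)      = v
toVal {m} (cons {N} j i) = scons j (var (N + suc (m ∸ toℕ i)))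

body : Comb m → Term
body f = spine (val (toVal (head f))) (map toVal (args f))

⟦_⟧ : Comb m → Val
⟦_⟧ {m} f = lam (lams m (body f))

inst : Vec Val m → Val → Atom m → Val
inst cs k (arg i)    = lookup cs i
inst cs k cont       = k
inst cs k (lit v _)  = v
inst cs k (cons j i) = scons j (lookup cs i)

fill : ∀ c → Closed c → Atom (suc m) → Atom m
fill c p (arg zero)       = lit c p
fill c p (arg (suc i))    = arg i
fill c p cont             = cont
fill c p (lit v q)        = lit v q
fill c p (cons j zero)    = lit (scons j c) (scons-scoped j (closed-scoped p))
fill c p (cons j (suc i)) = cons j i

inst-fill : ∀ (cs : Vec Val m) k p (a : Atom (suc m)) →
  inst cs k (fill c p a) ≡ inst (c ∷ cs) k a
inst-fill cs k p (arg zero)       = refl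
inst-fill cs k p (arg (suc i))    = refl
inst-fill cs k p cont             = refl
inst-fill cs k p (lit v q)        = refl
inst-fill cs k p (cons j zero)    = refl
inst-fill cs k p (cons j (suc i)) = refl

toVal-scoped : m < d → (a : Atom m) → ScopedV d (toVal a)
toVal-scoped {m} m<d (arg i)        = var (≤-<-trans (m∸n≤m m (toℕ i)) m<d)
toVal-scoped     m<d cont           = var (≤-<-trans z≤n m<d)
toVal-scoped     m<d (lit v p)      = closed-scoped p
toVal-scoped {m} m<d (cons {N} j i) =
  scons-scoped j (var (+-monoʳ-< N (s≤s (≤-<-trans (m∸n≤m m (toℕ i)) m<d))))

spine-scoped : m < d → ScopedT d t → (as : List (Atom m)) → ScopedT d (spine t (map toVal as))
spine-scoped m<d p []       = p
spine-scoped m<d p (a ∷ as) = spine-scoped m<d (app p (toVal-scoped m<d a)) as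

⟦⟧-closed : (f : Comb m) → Closed ⟦ f ⟧
⟦⟧-closed {m} (h ∙ as) = lam (lams-scoped m (spine-scoped m<m+1 (val (toVal-scoped m<m+1 h)) as))
  where
  m<m+1 : m < m + 1
  m<m+1 = m<m+n m (s≤s z≤n)

substV-toVal : ∀ p (a : Atom (suc m)) → substV (suc m) c (toVal a) ≡ toVal (fill c p a)
substV-toVal     p (arg zero)           = substVar-≡ _ refl
substV-toVal {m} p (arg (suc i))        = substVar-< _ (s≤s (m∸n≤m m (toℕ i)))
substV-toVal     p cont                 = refl
substV-toVal     p (lit v q)            = substV-closed _ q
substV-toVal     p (cons j zero)        =
  trans (substV-scons j p _) (cong (scons j) (substVar-≡ _ refl))
substV-toVal {m} p (cons {N} j (suc i)) =
  trans (substV-scons j p _) (cong (scons j) (substVar-< _ (+-monoʳ-< N (s≤s (s≤s (m∸n≤m m (toℕ i)))))))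

substV-toVal₀ : (a : Atom 0) → substV 0 k (toVal a) ≡ inst [] k a
substV-toVal₀ cont      = refl
substV-toVal₀ (lit v p) = substV-closed _ p

substT-body : ∀ (σ : Atom m → Val) → (∀ a → substV j c (toVal a) ≡ σ a) → (f : Comb m) →
  substT j c (body f) ≡ spine (val (σ (head f))) (map σ (args f))
substT-body {j = j} {c} σ eq (h ∙ as) =
  trans (substT-spine j c (val (toVal h)) (map toVal as))
        (cong₂ (λ v vs → spine (val v) vs) (eq h) (trans (sym (map-∘ as)) (map-cong eq as)))

fillᶜ : ∀ c → Closed c → Comb (suc m) → Comb m
fillᶜ c p (h ∙ as) = fill c p h ∙ map (fill c p) as

⟦⟧-β : ∀ p (f : Comb (suc m)) → app (val ⟦ f ⟧) c ⟶ val ⟦ fillᶜ c p f ⟧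
⟦⟧-β {m} {c} p f@(h ∙ as) = β≡ (trans (substT-lams (suc m) p) (cong (lams (suc m)) (begin
  substT (suc m + 0) c (body f)
    ≡⟨ cong (λ i → substT i c (body f)) (+-identityʳ (suc m)) ⟩
  substT (suc m) c (body f)
    ≡⟨ substT-body (toVal ∘ fill c p) (substV-toVal p) f ⟩
  spine (val (toVal (fill c p h))) (map (toVal ∘ fill c p) as)
    ≡⟨ cong (spine (val (toVal (fill c p h)))) (map-∘ as) ⟩
  body (fillᶜ c p f) ∎)))
  where open ≡-Reasoning

-- The combinator consumes its m closed arguments and then k, which may be open since
-- it is substituted last, when no λ is left above the body.
⟦⟧-⟶ : ∀ (cs : Vec Val m) → All Closed cs → ∀ k (f : Comb m) rest →
  spine (val ⟦ f ⟧) (toList cs ++ k ∷ rest) ⟶[ suc m ]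
    spine (val (inst cs k (head f))) (map (inst cs k) (args f) ++ rest)
⟦⟧-⟶ [] [] k f@(h ∙ as) rest =
  cast-target (sym (spine-++ _ (map (inst [] k) as) rest))
    (step (spine-⟶ rest (β≡ (substT-body (inst [] k) substV-toVal₀ f))) done)
⟦⟧-⟶ (c ∷ cs) (p ∷ ps) k f@(h ∙ as) rest =
  step (spine-⟶ (toList cs ++ k ∷ rest) (⟦⟧-β p f))
    (cast-target result≡ (⟦⟧-⟶ cs ps k (fillᶜ c p f) rest))
  where
  result≡ : spine (val (inst cs k (fill c p h))) (map (inst cs k) (map (fill c p) as) ++ rest)
         ≡ spine (val (inst (c ∷ cs) k h)) (map (inst (c ∷ cs) k) as ++ rest)
  result≡ = cong₂ (λ v vs → spine (val v) (vs ++ rest)) (inst-fill cs k p h)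
              (trans (sym (map-∘ as)) (map-cong (inst-fill cs k p) as))

lits : ∀ {n} → (bs : Vec Val n) → All Closed bs → List (Atom m)
lits []       []       = []
lits (b ∷ bs) (p ∷ ps) = lit b p ∷ lits bs ps

map-inst-lits : ∀ {n} (cs : Vec Val m) k (bs : Vec Val n) ps as rest →
  map (inst cs k) (lits bs ps ++ as) ++ rest ≡ toList bs ++ map (inst cs k) as ++ rest
map-inst-lits cs k []       []       as rest = refl
map-inst-lits cs k (b ∷ bs) (p ∷ ps) as rest = cong (b ∷_) (map-inst-lits cs k bs ps as rest)

⌜⌝str-closed : (w : List (Fin N)) → Closed ⌜ w ⌝str
⌜⌝str-closed []      = ⟦⟧-closed (cont ∙ [])
⌜⌝str-closed (i ∷ w) = ⟦⟧-closed (arg i ∙ (lit ⌜ w ⌝str (⌜⌝str-closed w) ∷ []))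

⌜⌝sym-closed : (i : Fin N) → Closed ⌜ i ⌝sym
⌜⌝sym-closed {suc N} i = lam (lams-scoped N (val (var (m∸n<m+[1+o] N (toℕ i) 0))))

⌜[]⌝-⟶ : ∀ (bs : Vec Val N) → All Closed bs → ∀ e rest →
  spine (val ⌜ [] ⌝str) (toList bs ++ e ∷ rest) ⟶[ suc N ] spine (val e) rest
⌜[]⌝-⟶ bs ps e rest = ⟦⟧-⟶ bs ps e (cont ∙ []) rest

⌜∷⌝-⟶ : ∀ (bs : Vec Val N) → All Closed bs → ∀ e rest i w →
  spine (val ⌜ i ∷ w ⌝str) (toList bs ++ e ∷ rest) ⟶[ suc N ]
    spine (val (lookup bs i)) (⌜ w ⌝str ∷ rest)
⌜∷⌝-⟶ bs ps e rest i w = ⟦⟧-⟶ bs ps e (arg i ∙ (lit ⌜ w ⌝str (⌜⌝str-closed w) ∷ [])) rest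

⌜⌝conf-⟶ : ∀ {M} s a r (q : State M) x rest →
  spine (val ⌜ config {M} s a r q ⌝conf) (x ∷ rest) ⟶[ 1 ]
    spine (val x) (⌜ reverse s ⌝str ∷ ⌜ a ⌝sym ∷ ⌜ r ⌝str ∷ ⌜ q ⌝sym ∷ rest)
⌜⌝conf-⟶ s a r q x rest = ⟦⟧-⟶ [] [] x (cont ∙ fields) rest
  where
  fields = lit _ (⌜⌝str-closed (reverse s)) ∷ lit _ (⌜⌝sym-closed a)
         ∷ lit _ (⌜⌝str-closed r) ∷ lit _ (⌜⌝sym-closed q) ∷ []

pass : Val → Term
pass x = val (lam (val (lam (app (app (val (var 0)) x) (var 1)))))

pass-⟶ : Closed x → ∀ k c → app (app (pass x) k) c ⟶[ 2 ] app (app (val c) x) k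
pass-⟶ {x} p k c =
  step (ctx (β≡ (cong (λ y → val (lam (app (app (val (var 0)) y) (shiftV 0 k)))) (substV-closed _ p))))
    (step (β≡ (cong₂ (λ y z → app (app (val c) y) z) (substV-closed _ p) (substV-shiftV 0 c k)))
      done)

push : ∀ {n} → Fin n → Comb 3
push j = arg (# 2) ∙ (arg (# 2) ∷ arg (# 0) ∷ cons j (# 1) ∷ cont ∷ [])

reverser : (bs : Vec Val N) → All Closed bs → ∀ e → Closed e → Comb 3
reverser bs ps e p = arg (# 1) ∙ (lits bs ps ++ lit e p ∷ arg (# 2) ∷ arg (# 0) ∷ cont ∷ [])

reverser-⟶ : ∀ (bs : Vec Val N) ps e p {g w acc} → Closed g → Closed w → Closed acc → ∀ k →
  spine (val ⟦ reverser bs ps e p ⟧) (g ∷ w ∷ acc ∷ k ∷ []) ⟶[ 4 ]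
    spine (val w) (toList bs ++ e ∷ acc ∷ g ∷ k ∷ [])
reverser-⟶ bs ps e p pg pw pacc k =
  cast-target (cong (spine (val _)) (map-inst-lits cs k bs ps _ []))
    (⟦⟧-⟶ cs (pg ∷ pw ∷ pacc ∷ []) k (reverser bs ps e p) [])
  where
  cs = _ ∷ _ ∷ _ ∷ []

reverseSteps : ℕ → ℕ → ℕ
reverseSteps N L = L * (N + 9) + (N + 5)

reverseSteps-suc : ∀ N L →
  4 + (suc N + (4 + (L * (N + 9) + (N + 5)))) ≡ suc L * (N + 9) + (N + 5)
reverseSteps-suc = solve-∀

module Reversal {n : ℕ} (bs : Vec Val N) (bs-closed : All Closed bs) (E : Val) (E-closed : Closed E)
                (e : Fin n → Fin N) (bs-push : ∀ j → lookup bs (e j) ≡ ⟦ push j ⟧) where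

  G : Val
  G = ⟦ reverser bs bs-closed E E-closed ⟧

  G-closed : Closed G
  G-closed = ⟦⟧-closed (reverser bs bs-closed E E-closed)

  push-⟶ : ∀ j {w acc} → Closed w → Closed acc → ∀ k →
    spine (val (lookup bs (e j))) (w ∷ acc ∷ G ∷ k ∷ []) ⟶[ 4 ]
      spine (val G) (G ∷ w ∷ scons j acc ∷ k ∷ [])
  push-⟶ j pw pacc k rewrite bs-push j =
    ⟦⟧-⟶ (_ ∷ _ ∷ _ ∷ []) (pw ∷ pacc ∷ G-closed ∷ []) k (push j) []

  reverse-⟶ : ∀ (w : List (Fin n)) acc k →
    spine (val G) (G ∷ ⌜ map e w ⌝str ∷ ⌜ acc ⌝str ∷ k ∷ []) ⟶[ reverseSteps N (length w) ]
      spine (val E) (⌜ w ʳ++ acc ⌝str ∷ G ∷ k ∷ [])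
  reverse-⟶ [] acc k = cast-steps (+-comm 5 N)
    (reverser-⟶ bs bs-closed E E-closed G-closed (⌜⌝str-closed []) (⌜⌝str-closed acc) k
     ◅◅ ⌜[]⌝-⟶ bs bs-closed E _)
  reverse-⟶ (j ∷ w) acc k = cast-steps (reverseSteps-suc N (length w))
    (reverser-⟶ bs bs-closed E E-closed G-closed (⌜⌝str-closed (e j ∷ map e w)) (⌜⌝str-closed acc) k
     ◅◅ ⌜∷⌝-⟶ bs bs-closed E _ (e j) (map e w)
     ◅◅ push-⟶ j (⌜⌝str-closed (map e w)) (⌜⌝str-closed acc) k
     ◅◅ reverse-⟶ w (j ∷ acc) k)

returnAcc : Comb 2
returnAcc = cont ∙ (arg (# 0) ∷ [])

wordTable : (n : ℕ) → Vec Val n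
wordTable n = tabulate (λ j → ⟦ push j ⟧)

wordTable-closed : (n : ℕ) → All Closed (wordTable n)
wordTable-closed n = tabulate⁺ (λ j → ⟦⟧-closed (push j))

wordTable-push : ∀ {n} (j : Fin n) → lookup (wordTable n) j ≡ ⟦ push j ⟧
wordTable-push j = lookup∘tabulate _ j

-- The blank never occurs in the tape contents read here, so its branch is arbitrary.
tapeTable : (n : ℕ) → Vec Val (suc n)
tapeTable n = wordTable n ∷ʳ ⟦ returnAcc ⟧

tapeTable-closed : (n : ℕ) → All Closed (tapeTable n)
tapeTable-closed n = All-∷ʳ (wordTable-closed n) (⟦⟧-closed returnAcc)

tapeTable-push : ∀ {n} (j : Fin n) → lookup (tapeTable n) (inject₁ j) ≡ ⟦ push j ⟧
tapeTable-push {n} j = trans (lookup-∷ʳ-inject₁ (wordTable n) _ j) (wordTable-push j)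

startReversal : (n : ℕ) → Comb 3 → Fin m → Comb m
startReversal n R i = G ∙ (G ∷ arg i ∷ lit ⌜ [] ⌝str (⌜⌝str-closed {n} []) ∷ cont ∷ [])
  where
  G = lit ⟦ R ⟧ (⟦⟧-closed R)

wordReverser : ℕ → Comb 3
wordReverser n = reverser (wordTable n) (wordTable-closed n) ⟦ returnAcc ⟧ (⟦⟧-closed returnAcc)

restart : ℕ → Comb 2
restart n = startReversal n (wordReverser n) (# 0)

tapeReverser : ℕ → Comb 3
tapeReverser n =
  reverser (tapeTable n) (tapeTable-closed n) ⟦ restart n ⟧ (⟦⟧-closed (restart n))

unpack : ℕ → Comb 4
unpack n = startReversal n (tapeReverser n) (# 2)

final : ℕ → Term
final n = pass ⟦ unpack n ⟧

finalSteps : ℕ → ℕ → ℕ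
finalSteps n L = L * (19 + 2 * n) + (25 + 2 * n)

finalSteps-≡ : ∀ n L →
  2 + (1 + (5 + (L * (suc n + 9) + (suc n + 5) + (3 + (L * (n + 9) + (n + 5) + 3)))))
    ≡ L * (19 + 2 * n) + (25 + 2 * n)
finalSteps-≡ = solve-∀

final-⟶ : (M : TM) → ∀ k (s : List (Sym M)) →
  app (app (final (TM.n M)) k) ⌜ finalConfig M s ⌝conf ⟶[ finalSteps (TM.n M) (length s) ]
    app (val k) ⌜ s ⌝str
final-⟶ M k s =
  cast-steps (finalSteps-≡ n (length s))
    (cast-target (cong (λ w → app (val k) ⌜ w ⌝str) (reverse-involutive s))
      (pass-⟶ (⟦⟧-closed (unpack n)) k _
       ◅◅ ⌜⌝conf-⟶ {M} [] (blank M) (map inject₁ s) (TM.qfin M) ⟦ unpack n ⟧ (k ∷ [])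
       ◅◅ ⟦⟧-⟶ (_ ∷ _ ∷ _ ∷ _ ∷ []) config-closed k (unpack n) []
       ◅◅ Tape.reverse-⟶ s [] k
       ◅◅ ⟦⟧-⟶ (_ ∷ _ ∷ []) (⌜⌝str-closed (reverse s) ∷ Tape.G-closed ∷ []) k (restart n) []
       ◅◅ reverseWord
       ◅◅ ⟦⟧-⟶ (_ ∷ _ ∷ []) (⌜⌝str-closed (reverse (reverse s)) ∷ Word.G-closed ∷ []) k returnAcc []))
  where
  n = TM.n M
  module Tape = Reversal (tapeTable n) (tapeTable-closed n) ⟦ restart n ⟧ (⟦⟧-closed (restart n))
                         inject₁ tapeTable-push
  module Word = Reversal (wordTable n) (wordTable-closed n) ⟦ returnAcc ⟧ (⟦⟧-closed returnAcc)
                         id wordTable-push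

  config-closed :
    All Closed (⌜_⌝str {suc n} [] ∷ ⌜ blank M ⌝sym ∷ ⌜ map inject₁ s ⌝str ∷ ⌜ TM.qfin M ⌝sym ∷ [])
  config-closed = ⌜⌝str-closed {suc n} [] ∷ ⌜⌝sym-closed (blank M) ∷ ⌜⌝str-closed (map inject₁ s)
                ∷ ⌜⌝sym-closed (TM.qfin M) ∷ []

  reverseWord : spine (val Word.G) (Word.G ∷ ⌜ reverse s ⌝str ∷ ⌜_⌝str {n} [] ∷ k ∷ [])
                  ⟶[ reverseSteps n (length s) ]
                spine (val ⟦ returnAcc ⟧) (⌜ reverse (reverse s) ⌝str ∷ Word.G ∷ k ∷ [])
  reverseWord = cast-steps (cong (reverseSteps n) (length-reverse s))
    (cast-source (cong (λ w → spine (val Word.G) (Word.G ∷ ⌜ w ⌝str ∷ ⌜_⌝str {n} [] ∷ k ∷ []))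
                       (sym (map-id _)))
      (Word.reverse-⟶ (reverse s) [] k))

finalSteps-≥ : ∀ n L → (19 + 2 * n) * L ≤ finalSteps n L
finalSteps-≥ n L = subst (_≤ finalSteps n L) (*-comm L (19 + 2 * n)) (m≤m+n _ _)

finalSteps-≤ : ∀ n L → finalSteps n L ≤ (25 + 2 * n) * suc L
finalSteps-≤ n L = subst (finalSteps n L ≤_) (sym (slack n L)) (m≤m+n _ (6 * L))
  where
  slack : ∀ n L → (25 + 2 * n) * suc L ≡ L * (19 + 2 * n) + (25 + 2 * n) + 6 * L
  slack = solve-∀

lemma6 : (M : TM) →
    Σ Term λ final →
    ∃ λ (c₁ : ℕ) → ∃ λ (c₂ : ℕ) → 0 < c₁ ×
      ((k : Val) (s : List (Sym M)) →
        ∃ λ (steps : ℕ) →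
          (app (app final k) ⌜ finalConfig M s ⌝conf ⟶[ steps ] app (val k) ⌜ s ⌝str)
          × c₁ * length s ≤ steps
          × steps ≤ c₂ * suc (length s))
lemma6 M = final n , 19 + 2 * n , 25 + 2 * n , s≤s z≤n ,
  λ k s → finalSteps n (length s) , final-⟶ M k s ,
           finalSteps-≥ n (length s) , finalSteps-≤ n (length s)
  where
  n = TM.n M
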